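{- $\kappa(Q_3;C_4)=2$.
   Context: $Q_3$ is the $3$-dimensional hypercube: its vertices are the binary strings of length $3$, two vertices being adjacent iff they differ in exactly one position. $C_4$ is the cycle of length $4$. For connected graphs $G,H$, an $H$-structure cut of $G$ is a set $F$ of subgraphs of $G$, each isomorphic to $H$, such that $G-V(F)$ is disconnected or trivial (a single vertex); $\kappa(G;H)$ is the minimum cardinality of an $H$-structure cut of $G$. -}

module Defs where

open import Data.Nat using (ℕ; zero; suc; _≤_; _%_)
open import Data.Bool using (Bool; true; false; _≟_)
open import Data.Fin using (Fin; toℕ)
open import Data.Vec using (Vec; []; _∷_)
open import Data.List using (List; length)
open import Data.List.Relation.Unary.All using (All)
open import Data.List.Relation.Unary.Any using (Any)
open import Data.List.Relation.Unary.AllPairs using (AllPairs)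
open import Data.Product using (Σ; ∃; _×_; _,_)
open import Data.Sum using (_⊎_)
open import Relation.Nullary using (¬_; yes; no)
open import Relation.Binary.PropositionalEquality using (_≡_)
open import Function.Bundles using (_⇔_)

record Graph : Set₁ where
  field
    V : Set
    E : V → V → Set

open Graph public

record Subgraph (G : Graph) : Set₁ where
  field
    sV : V G → Set
    sE : V G → V G → Set
    sE⊆E : ∀ {u v} → sE u v → E G u v
    sE-src : ∀ {u v} → sE u v → sV u
    sE-tgt : ∀ {u v} → sE u v → sV v

open Subgraph public

SameSubgraph : {G : Graph} → Subgraph G → Subgraph G → Set
SameSubgraph {G} S T =
  (∀ v → sV S v ⇔ sV T v) × (∀ u v → sE S u v ⇔ sE T u v)

IsoTo : {G : Graph} → Subgraph G → Graph → Set
IsoTo {G} S H =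
  Σ (V H → V G) λ f →
    (∀ i j → f i ≡ f j → i ≡ j)
    × (∀ i → sV S (f i))
    × (∀ v → sV S v → ∃ λ i → f i ≡ v)
    × (∀ i j → E H i j ⇔ sE S (f i) (f j))

InV : {G : Graph} → List (Subgraph G) → V G → Set₁
InV F v = Any (λ S → sV S v) F

Remains : {G : Graph} → List (Subgraph G) → V G → Set₁
Remains F v = ¬ InV F v

data Walk (G : Graph) (P : V G → Set₁) : V G → V G → Set₁ where
  here : ∀ {u} → P u → Walk G P u u
  step : ∀ {u w v} → P u → E G u w → Walk G P w v → Walk G P u v

DisconnectedOrTrivial : (G : Graph) → List (Subgraph G) → Set₁
DisconnectedOrTrivial G F =
  (∀ u v → Remains F u → Remains F v → u ≡ v)
  ⊎ (∃ λ u → ∃ λ v → Remains F u × Remains F v × ¬ Walk G (Remains F) u v)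

-- F is an H-structure cut of G (F given as a list of pairwise distinct
-- subgraphs, so its cardinality is its length).
IsStructureCut : (G H : Graph) → List (Subgraph G) → Set₁
IsStructureCut G H F =
  All (λ S → IsoTo S H) F
  × AllPairs (λ S T → ¬ SameSubgraph S T) F
  × DisconnectedOrTrivial G F

StructureConnectivityIs : (G H : Graph) → ℕ → Set₁
StructureConnectivityIs G H k =
  (∃ λ F → IsStructureCut G H F × length F ≡ k)
  × (∀ F → IsStructureCut G H F → k ≤ length F)

hamming : ∀ {n} → Vec Bool n → Vec Bool n → ℕ
hamming [] [] = 0
hamming (x ∷ xs) (y ∷ ys) with x ≟ y
... | yes _ = hamming xs ys
... | no _ = suc (hamming xs ys)

Q : ℕ → Graph
Q n = record { V = Vec Bool n ; E = λ u v → hamming u v ≡ 1 }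

C : (n : ℕ) → Graph
C zero = record { V = Fin zero ; E = λ _ _ → Fin zero }
C (suc m) = record
  { V = Fin (suc m)
  ; E = λ i j → (toℕ j ≡ suc (toℕ i) % suc m) ⊎ (toℕ i ≡ suc (toℕ j) % suc m)
  }

-- Two opposite faces of Q₃ are 4-cycles covering every vertex, so removing
-- them leaves the empty graph, which is trivial.  Conversely, Q₃ itself is
-- connected, and removing the vertices of any one 4-cycle of Q₃ leaves the
-- opposite face, again a connected graph with more than one vertex.  The
-- second fact is checked exhaustively over all 4-cycles, each connection
-- being witnessed by a walk that a bounded search finds.
module Submission where

open import Defs
open import Level using (Lift; lift; lower)
open import Data.Nat using (ℕ; zero; suc; _≤_; z≤n; s≤s)
import Data.Nat.Properties as ℕ
open import Data.Bool using (Bool; true; false; T)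
import Data.Bool as Bool
open import Data.Fin using (Fin; zero; suc; toℕ)
import Data.Fin.Properties as Fin
open import Data.Vec using (Vec; []; _∷_; head; replicate)
import Data.Vec.Properties as Vec
open import Data.Maybe using (Maybe; just; nothing; is-just; _<∣>_; to-witness-T)
import Data.Maybe as Maybe
open import Data.List using (List; []; _∷_; _++_; map; foldr; tabulate; length)
open import Data.List.Membership.Propositional using (_∈_; _∉_; lose)
open import Data.List.Membership.Propositional.Properties
  using (∈-map⁺; ∈-++⁺ˡ; ∈-++⁺ʳ; ∈-tabulate⁺; ∈-tabulate⁻)
import Data.List.Relation.Unary.All as All
open import Data.List.Relation.Unary.All using ([]; _∷_)
import Data.List.Relation.Unary.Any as Any
open import Data.List.Relation.Unary.Any using (here; there)
open import Data.List.Relation.Unary.AllPairs using ([]; _∷_)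
open import Data.Product using (∃; _×_; _,_; proj₁; proj₂; swap)
open import Data.Sum using (inj₁; inj₂)
open import Data.Unit using (⊤; tt)
open import Data.Empty using (⊥-elim)
open import Function using (_∘_; case_of_)
open import Function.Bundles using (_⇔_; mk⇔; Equivalence)
open import Relation.Nullary using (¬_; Dec; yes; no; ¬?)
open import Relation.Nullary.Decidable using (_×-dec_; _⊎-dec_; _→-dec_; map′; from-yes)
open import Relation.Unary using (Pred; Decidable; _⊆_; _≐_)
open import Relation.Binary.PropositionalEquality
  using (_≡_; _≢_; refl; sym; trans; cong)
open import Relation.Binary.Definitions using (DecidableEquality)

Connected : (G : Graph) → (V G → Set₁) → Set₁
Connected G P = ∀ u v → P u → P v → Walk G P u v

Nontrivial : {A : Set} → (A → Set₁) → Set₁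
Nontrivial P = ∃ λ u → ∃ λ v → P u × P v × u ≢ v

Nontrivial-resp : {A : Set} {P P′ : A → Set₁} → P ≐ P′ → Nontrivial P → Nontrivial P′
Nontrivial-resp (P⊆P′ , _) (u , v , pu , pv , u≢v) = u , v , P⊆P′ pu , P⊆P′ pv , u≢v

module _ {G : Graph} where

  Walk-map : ∀ {P P′} → P ⊆ P′ → ∀ {u v} → Walk G P u v → Walk G P′ u v
  Walk-map P⊆P′ (here p) = here (P⊆P′ p)
  Walk-map P⊆P′ (step p e w) = step (P⊆P′ p) e (Walk-map P⊆P′ w)

  Connected-resp : ∀ {P P′} → P ≐ P′ → Connected G P → Connected G P′
  Connected-resp (P⊆P′ , P′⊆P) conn u v pu pv = Walk-map P⊆P′ (conn u v (P′⊆P pu) (P′⊆P pv))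

  connected-nontrivial⇒¬cut : ∀ {F P} → Remains F ≐ P → Nontrivial P × Connected G P →
                              ¬ DisconnectedOrTrivial G F
  connected-nontrivial⇒¬cut {F} Remains≐P (nontrivial , connected) = refute
    where
    P≐Remains = swap Remains≐P

    refute : ¬ DisconnectedOrTrivial G F
    refute (inj₁ trivial) =
      let u , v , ru , rv , u≢v = Nontrivial-resp P≐Remains nontrivial in u≢v (trivial u v ru rv)
    refute (inj₂ (u , v , ru , rv , ¬walk)) = ¬walk (Connected-resp P≐Remains connected u v ru rv)

Outside : {A : Set} → List A → A → Set₁
Outside xs v = Lift _ (v ∉ xs)

Remains-[] : {G : Graph} → Remains {G} [] ≐ Outside []
Remains-[] = (λ _ → lift λ ()) , (λ _ ())

Remains-image : {G : Graph} {n : ℕ} {S : Subgraph G} (f : Fin n → V G) →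
                (∀ i → sV S (f i)) → (∀ v → sV S v → ∃ λ i → f i ≡ v) →
                Remains (S ∷ []) ≐ Outside (tabulate f)
Remains-image {S = S} f in-S onto-S =
  (λ r → lift λ v∈f → r (here (image⊆S v∈f))) ,
  (λ { (lift v∉f) (here s) → v∉f (S⊆image s) })
  where
  image⊆S : ∀ {v} → v ∈ tabulate f → sV S v
  image⊆S v∈f with ∈-tabulate⁻ v∈f
  ... | i , refl = in-S i

  S⊆image : ∀ {v} → sV S v → v ∈ tabulate f
  S⊆image {v} s with onto-S v s
  ... | i , refl = ∈-tabulate⁺ i

-- The bounded search is sound but not complete; it is only ever run where
-- it evaluates to a success.
module FiniteGraph (G : Graph) (_≟_ : DecidableEquality (V G))
                   (E? : ∀ u v → Dec (E G u v))
                   (vertices : List (V G)) (∈-vertices : ∀ v → v ∈ vertices) where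

  ∀? : ∀ {p} {P : Pred (V G) p} → Decidable P → Dec (∀ v → P v)
  ∀? P? = map′ (λ all v → All.lookup all (∈-vertices v))
               (λ all → All.tabulate (λ {v} _ → all v))
               (All.all? P? vertices)

  ∃? : ∀ {p} {P : Pred (V G) p} → Decidable P → Dec (∃ P)
  ∃? P? = map′ Any.satisfied (λ (v , pv) → lose (∈-vertices v) pv) (Any.any? P? vertices)

  module _ {P : V G → Set₁} (P? : Decidable P) where

    walk≤ : ℕ → ∀ u v → Maybe (Walk G P u v)
    walk≤ n u v with P? u
    ... | no _ = nothing
    ... | yes pu with u ≟ v
    ...   | yes refl = just (here pu)
    walk≤ zero u v | yes pu | no _ = nothing
    walk≤ (suc n) u v | yes pu | no _ = foldr (λ w found → via w <∣> found) nothing vertices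
      where
      via : ∀ w → Maybe (Walk G P u v)
      via w with E? u w
      ... | yes e = Maybe.map (step pu e) (walk≤ n w v)
      ... | no _ = nothing

    connected? : ℕ → Maybe (Connected G P)
    connected? n
      with ∀? (λ u → ∀? λ v → P? u →-dec (P? v →-dec Bool.T? (is-just (walk≤ n u v))))
    ... | yes found = just λ u v pu pv → to-witness-T (walk≤ n u v) (found u v pu pv)
    ... | no _ = nothing

    nontrivial? : Dec (Nontrivial P)
    nontrivial? = ∃? λ u → ∃? λ v → P? u ×-dec (P? v ×-dec ¬? (u ≟ v))

  Outside? : (xs : List (V G)) → Decidable (Outside xs)
  Outside? xs v = map′ lift lower (¬? (Any.any? (v ≟_) xs))

cube : ∀ n → List (Vec Bool n)
cube zero = [] ∷ []
cube (suc n) = map (false ∷_) (cube n) ++ map (true ∷_) (cube n)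

∈-cube : ∀ {n} (v : Vec Bool n) → v ∈ cube n
∈-cube [] = here refl
∈-cube {suc n} (false ∷ v) = ∈-++⁺ˡ (∈-map⁺ (false ∷_) (∈-cube v))
∈-cube {suc n} (true ∷ v) = ∈-++⁺ʳ (map (false ∷_) (cube n)) (∈-map⁺ (true ∷_) (∈-cube v))

Q-adjacent? : ∀ {n} (u v : Vec Bool n) → Dec (E (Q n) u v)
Q-adjacent? u v = hamming u v ℕ.≟ 1

module Cube (n : ℕ) = FiniteGraph (Q n) (Vec.≡-dec Bool._≟_) Q-adjacent? (cube n) ∈-cube

FourCycle : ∀ {n} → Vec Bool n → Vec Bool n → Vec Bool n → Vec Bool n → Set
FourCycle {n} a b c d =
  E (Q n) a b × E (Q n) b c × E (Q n) c d × E (Q n) d a × a ≢ c × b ≢ d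

FourCycle? : ∀ {n} (a b c d : Vec Bool n) → Dec (FourCycle a b c d)
FourCycle? a b c d =
  Q-adjacent? a b ×-dec (Q-adjacent? b c ×-dec (Q-adjacent? c d ×-dec (Q-adjacent? d a ×-dec
  (¬? (Vec.≡-dec Bool._≟_ a c) ×-dec ¬? (Vec.≡-dec Bool._≟_ b d)))))

-- Search depths: Q₃ has diameter 3, and the opposite face left by a 4-cycle
-- has diameter 2.
module _ where
  open Cube 3

  Q₃-connected : Nontrivial (Outside []) × Connected (Q 3) (Outside [])
  Q₃-connected = from-yes (nontrivial? (Outside? [])) , to-witness-T (connected? (Outside? []) 3) tt

  Q₃-minus-4-cycle-connected :
    ∀ a b c d → FourCycle a b c d →
    let P = Outside (a ∷ b ∷ c ∷ d ∷ []) in Nontrivial P × Connected (Q 3) P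
  Q₃-minus-4-cycle-connected a b c d cycle =
    let nontrivial , found = from-yes all-4-cycles a b c d cycle
    in nontrivial , to-witness-T _ found
    where
    Outside₄? : ∀ a b c d → Decidable (Outside (a ∷ b ∷ c ∷ d ∷ []))
    Outside₄? a b c d = Outside? (a ∷ b ∷ c ∷ d ∷ [])

    all-4-cycles : Dec (∀ a b c d → FourCycle a b c d →
                        Nontrivial (Outside (a ∷ b ∷ c ∷ d ∷ [])) ×
                        T (is-just (connected? (Outside₄? a b c d) 2)))
    all-4-cycles = ∀? λ a → ∀? λ b → ∀? λ c → ∀? λ d → FourCycle? a b c d →-dec
                     (nontrivial? (Outside₄? a b c d) ×-dec
                      Bool.T? (is-just (connected? (Outside₄? a b c d) 2)))

single-C₄-not-cut : (S : Subgraph (Q 3)) → IsoTo S (C 4) → ¬ DisconnectedOrTrivial (Q 3) (S ∷ [])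
single-C₄-not-cut S (f , injective , in-S , onto-S , edges) =
  connected-nontrivial⇒¬cut (Remains-image f in-S onto-S) (Q₃-minus-4-cycle-connected _ _ _ _ cycle)
  where
  adjacent : ∀ i j → E (C 4) i j → E (Q 3) (f i) (f j)
  adjacent i j = sE⊆E S ∘ Equivalence.to (edges i j)

  cycle : FourCycle (f zero) (f (suc zero)) (f (suc (suc zero))) (f (suc (suc (suc zero))))
  cycle = adjacent _ _ (inj₁ refl) , adjacent _ _ (inj₁ refl) , adjacent _ _ (inj₁ refl) ,
          adjacent _ _ (inj₁ refl) , (λ eq → case injective _ _ eq of λ ()) ,
          (λ eq → case injective _ _ eq of λ ())

whole : (G : Graph) → Subgraph G
whole G = record
  { sV = λ _ → ⊤ ; sE = E G ; sE⊆E = λ e → e ; sE-src = λ _ → tt ; sE-tgt = λ _ → tt }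

face : ∀ {n} → Bool → Subgraph (Q (suc n))
face {n} x = record
  { sV = λ v → head v ≡ x
  ; sE = λ u v → head u ≡ x × head v ≡ x × E (Q (suc n)) u v
  ; sE⊆E = proj₂ ∘ proj₂
  ; sE-src = proj₁
  ; sE-tgt = proj₁ ∘ proj₂
  }

hamming-∷ : ∀ {n} x (u v : Vec Bool n) → hamming (x ∷ u) (x ∷ v) ≡ hamming u v
hamming-∷ false u v = refl
hamming-∷ true u v = refl

face-iso : ∀ {n H} x → IsoTo (whole (Q n)) H → IsoTo (face x) H
face-iso {H = H} x (g , injective , _ , onto , edges) =
  (x ∷_) ∘ g , (λ i j → injective i j ∘ Vec.∷-injectiveʳ) , (λ _ → refl) , onto-face , edges-face
  where
  onto-face : ∀ v → head v ≡ x → ∃ λ i → x ∷ g i ≡ v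
  onto-face (.x ∷ w) refl = let i , gi≡w = onto w tt in i , cong (x ∷_) gi≡w

  edges-face : ∀ i j → E H i j ⇔ (x ≡ x × x ≡ x × hamming (x ∷ g i) (x ∷ g j) ≡ 1)
  edges-face i j rewrite hamming-∷ x (g i) (g j) =
    mk⇔ (λ e → refl , refl , Equivalence.to (edges i j) e)
        (λ (_ , _ , e) → Equivalence.from (edges i j) e)

opposite-faces-cut : ∀ {n H} → IsoTo (whole (Q n)) H →
                     IsStructureCut (Q (suc n)) H (face false ∷ face true ∷ [])
opposite-faces-cut {n} Qₙ≅H =
  (face-iso false Qₙ≅H ∷ face-iso true Qₙ≅H ∷ []) ,
  (distinct ∷ []) ∷ [] ∷ [] ,
  inj₁ λ u _ ru _ → ⊥-elim (covered u ru)
  where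
  distinct : ¬ SameSubgraph (face false) (face true)
  distinct (sameV , _) with Equivalence.to (sameV (false ∷ replicate n false)) refl
  ... | ()

  covered : ∀ v → ¬ Remains (face false ∷ face true ∷ []) v
  covered (false ∷ _) r = r (here refl)
  covered (true ∷ _) r = r (there (here refl))

square : Fin 4 → Vec Bool 2
square zero = false ∷ false ∷ []
square (suc zero) = false ∷ true ∷ []
square (suc (suc zero)) = true ∷ true ∷ []
square (suc (suc (suc zero))) = true ∷ false ∷ []

corner : Vec Bool 2 → Fin 4
corner (false ∷ false ∷ []) = zero
corner (false ∷ true ∷ []) = suc zero
corner (true ∷ true ∷ []) = suc (suc zero)
corner (true ∷ false ∷ []) = suc (suc (suc zero))

corner-square : ∀ i → corner (square i) ≡ i
corner-square zero = refl
corner-square (suc zero) = refl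
corner-square (suc (suc zero)) = refl
corner-square (suc (suc (suc zero))) = refl

square-corner : ∀ v → square (corner v) ≡ v
square-corner (false ∷ false ∷ []) = refl
square-corner (false ∷ true ∷ []) = refl
square-corner (true ∷ true ∷ []) = refl
square-corner (true ∷ false ∷ []) = refl

C-adjacent? : ∀ m (i j : Fin (suc m)) → Dec (E (C (suc m)) i j)
C-adjacent? m i j = (toℕ j ℕ.≟ _) ⊎-dec (toℕ i ℕ.≟ _)

Q₂≅C₄ : IsoTo (whole (Q 2)) (C 4)
Q₂≅C₄ = square , injective , (λ _ → tt) , (λ v _ → corner v , square-corner v) , edges
  where
  injective : ∀ i j → square i ≡ square j → i ≡ j
  injective i j eq = trans (sym (corner-square i)) (trans (cong corner eq) (corner-square j))

  edges : ∀ i j → E (C 4) i j ⇔ E (Q 2) (square i) (square j)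
  edges i j = let to , from = checked i j in mk⇔ to from
    where
    checked : ∀ i j → (E (C 4) i j → E (Q 2) (square i) (square j)) ×
                      (E (Q 2) (square i) (square j) → E (C 4) i j)
    checked = from-yes (Fin.all? λ i → Fin.all? λ j →
                let q? = Q-adjacent? (square i) (square j)
                in (C-adjacent? 3 i j →-dec q?) ×-dec (q? →-dec C-adjacent? 3 i j))

lemma19 : StructureConnectivityIs (Q 3) (C 4) 2
lemma19 = (face false ∷ face true ∷ [] , opposite-faces-cut Q₂≅C₄ , refl) , at-least-two
  where
  at-least-two : ∀ F → IsStructureCut (Q 3) (C 4) F → 2 ≤ length F
  at-least-two [] (_ , _ , cut) = ⊥-elim (connected-nontrivial⇒¬cut Remains-[] Q₃-connected cut)
  at-least-two (S ∷ []) (S≅C₄ ∷ [] , _ , cut) = ⊥-elim (single-C₄-not-cut S S≅C₄ cut)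
  at-least-two (_ ∷ _ ∷ _) _ = s≤s (s≤s z≤n)
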